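{- Let $\alpha,\beta,k_0,k_1,k_2,k_3$ be non-negative integers with $k_0\le\alpha$ and $l:=k_1+k_2+k_3\le\beta$. If $\alpha k_2=k_0(k_2+k_3)$, then $$N_{2\times 8}(\alpha,\beta;k_0,k_1,k_2,k_3)=N_{2\times 8}(\alpha,\beta;\alpha-k_0,\beta-l,k_3,k_2).$$
   Context: For non-negative integers $\alpha,\beta,k_0,k_1,k_2,k_3$ define $N_{2\times 8}(\alpha,\beta;k_0,k_1,k_2,k_3)=\frac{N_1N_2N_3N_4}{D_1D_2D_3D_4}$ with $N_1=\prod_{i=0}^{k_0-1}((2^{\alpha}-2^{i})2^{\beta})$, $N_2=\prod_{i=0}^{k_1-1}((8^{\beta}-4^{\beta}2^{i})2^{\alpha})$, $N_3=\prod_{i=0}^{k_2-1}((4^{\beta}-2^{\beta+k_1+i})2^{\alpha})$, $N_4=\prod_{i=0}^{k_3-1}(2^{\beta}-2^{k_1+k_2+i})$, $D_1=\prod_{i=0}^{k_0-1}(2^{k_0+k_1+k_2+k_3}-2^{k_1+k_2+k_3+i})$, $D_2=\prod_{i=0}^{k_1-1}((8^{k_1}-4^{k_1}2^{i})2^{k_0+2k_2+k_3})$, $D_3=\prod_{i=0}^{k_2-1}((4^{k_2}-2^{k_2+i})2^{k_0+2k_1+k_3})$, $D_4=\prod_{i=0}^{k_3-1}(2^{k_1+k_2+k_3}-2^{k_1+k_2+i})$; empty products equal $1$. The parameters $(\alpha,\beta;\alpha-k_0,\beta-l,k_3,k_2)$ are the type parameters of the dual of a $\mathbb{Z}_2\mathbb{Z}_8$-additive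 code of type $(\alpha,\beta;k_0,k_1,k_2,k_3)$. -}

module Defs where

import Data.Nat
import Data.Nat as ℕ
open ℕ using (ℕ; zero; suc)
open import Data.Integer as ℤ using (ℤ)
open import Data.Rational as ℚ using (ℚ; 0ℚ; _÷_; _≟_)
open import Relation.Nullary using (yes; no)

∏ : ℕ → (ℕ → ℚ) → ℚ
∏ zero    f = ℚ.1ℚ
∏ (suc n) f = ∏ n f ℚ.* f n

2^ : ℕ → ℚ
2^ n = (ℤ.+ (2 ℕ.^ n)) ℚ./ 1

-- total division on ℚ; only used with nonzero denominators
-- (all D_j below are products of positive factors)
_÷'_ : ℚ → ℚ → ℚ
p ÷' q with q ≟ 0ℚ
... | yes _ = 0ℚ
... | no q≢0 = _÷_ p q {{ℚ.≢-nonZero q≢0}}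

N2x8 : ℕ → ℕ → ℕ → ℕ → ℕ → ℕ → ℚ
N2x8 α β k₀ k₁ k₂ k₃ = (N₁ ℚ.* N₂ ℚ.* N₃ ℚ.* N₄) ÷' (D₁ ℚ.* D₂ ℚ.* D₃ ℚ.* D₄)
  where
  open Data.Nat using (_+_; _*_)
  N₁ = ∏ k₀ (λ i → (2^ α ℚ.- 2^ i) ℚ.* 2^ β)
  N₂ = ∏ k₁ (λ i → (2^ (3 * β) ℚ.- 2^ (2 * β) ℚ.* 2^ i) ℚ.* 2^ α)
  N₃ = ∏ k₂ (λ i → (2^ (2 * β) ℚ.- 2^ (β + k₁ + i)) ℚ.* 2^ α)
  N₄ = ∏ k₃ (λ i → 2^ β ℚ.- 2^ (k₁ + k₂ + i))
  D₁ = ∏ k₀ (λ i → 2^ (k₀ + k₁ + k₂ + k₃) ℚ.- 2^ (k₁ + k₂ + k₃ + i))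
  D₂ = ∏ k₁ (λ i → (2^ (3 * k₁) ℚ.- 2^ (2 * k₁) ℚ.* 2^ i) ℚ.* 2^ (k₀ + 2 * k₂ + k₃))
  D₃ = ∏ k₂ (λ i → (2^ (2 * k₂) ℚ.- 2^ (k₂ + i)) ℚ.* 2^ (k₀ + 2 * k₁ + k₃))
  D₄ = ∏ k₃ (λ i → 2^ (k₁ + k₂ + k₃) ℚ.- 2^ (k₁ + k₂ + i))

-- Write F n k = falling₂ n k = ∏_{i<k} (2^n − 2^i). Every factor of every Nᵢ and Dᵢ is a power of two times a
-- difference 2^m − 2^j, so N2x8 is 2^e · F α k₀ · F β l over F k₀ k₀ · F k₁ k₁ · F k₂ k₂ · F k₃ k₃.
-- Splitting off the last r indices gives F (k + r) k · F r r · 2^(rk) = F (k + r) (k + r); hence after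
-- cross-multiplication and clearing powers of two both sides become
-- F α α · F β β · F k₂ k₂ · F k₃ k₃ times a power of two.  The two exponents differ by
-- (α − k₀) k₂ − k₀ k₃, which vanishes by the hypothesis α k₂ = k₀ (k₂ + k₃).

module Submission where

open import Defs
open import Data.Nat as ℕ using (ℕ; zero; suc; _+_; _*_; _∸_; _≤_; _<_)
import Data.Nat.Properties as ℕₚ
open import Data.Nat.Tactic.RingSolver using () renaming (solve to ℕ-solve)
open import Data.List using ([]; _∷_)
import Data.Integer as ℤ
import Data.Integer.Properties as ℤₚ
open import Data.Rational as ℚ using (ℚ; mkℚ; 0ℚ; 1ℚ)
import Data.Rational.Properties as ℚₚ
open import Data.Rational.Solver using (module +-*-Solver)
import Data.Nat.Coprimality as Coprime
open import Algebra.Bundles using (CommutativeMonoid)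
open import Algebra.Properties.CommutativeSemigroup
  (CommutativeMonoid.commutativeSemigroup ℚₚ.*-1-commutativeMonoid) using (interchange; xy∙z≈xz∙y)
open import Algebra.Properties.Group ℚₚ.+-0-group using (x∙y⁻¹≈ε⇒x≈y)
open import Relation.Binary.PropositionalEquality
open import Relation.Nullary using (yes; no)
open import Data.Empty using (⊥-elim)

*-cancelʳ-≡ : ∀ {u v t} → t ≢ 0ℚ → u ℚ.* t ≡ v ℚ.* t → u ≡ v
*-cancelʳ-≡ {u} {v} {t} t≢0 e = begin
    u                         ≡⟨ sym (ℚₚ.*-identityʳ u) ⟩
    u ℚ.* 1ℚ                  ≡⟨ cong (u ℚ.*_) (sym (ℚₚ.*-inverseʳ t)) ⟩
    u ℚ.* (t ℚ.* ℚ.1/ t)      ≡⟨ sym (ℚₚ.*-assoc u t _) ⟩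
    (u ℚ.* t) ℚ.* ℚ.1/ t      ≡⟨ cong (ℚ._* ℚ.1/ t) e ⟩
    (v ℚ.* t) ℚ.* ℚ.1/ t      ≡⟨ ℚₚ.*-assoc v t _ ⟩
    v ℚ.* (t ℚ.* ℚ.1/ t)      ≡⟨ cong (v ℚ.*_) (ℚₚ.*-inverseʳ t) ⟩
    v ℚ.* 1ℚ                  ≡⟨ ℚₚ.*-identityʳ v ⟩
    v                         ∎
  where
  open ≡-Reasoning
  instance _ = ℚ.≢-nonZero t≢0

*≢0 : ∀ {x y} → x ≢ 0ℚ → y ≢ 0ℚ → x ℚ.* y ≢ 0ℚ
*≢0 {x} {y} x≢0 y≢0 xy≡0 = x≢0 (*-cancelʳ-≡ y≢0 (trans xy≡0 (sym (ℚₚ.*-zeroˡ y))))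

÷'-cross : ∀ {x y z w} → y ≢ 0ℚ → w ≢ 0ℚ → x ℚ.* w ≡ z ℚ.* y → x ÷' y ≡ z ÷' w
÷'-cross {x} {y} {z} {w} y≢0 w≢0 e with y ℚ.≟ 0ℚ | w ℚ.≟ 0ℚ
... | yes y≡0 | _       = ⊥-elim (y≢0 y≡0)
... | no _    | yes w≡0 = ⊥-elim (w≢0 w≡0)
... | no _    | no _    = *-cancelʳ-≡ (*≢0 y≢0 w≢0) (begin
    x ℚ.* ℚ.1/ y ℚ.* (y ℚ.* w)       ≡⟨ swap x (ℚ.1/ y) y w ⟩
    (x ℚ.* w) ℚ.* (y ℚ.* ℚ.1/ y)     ≡⟨ cong₂ ℚ._*_ e (ℚₚ.*-inverseʳ y) ⟩
    (z ℚ.* y) ℚ.* 1ℚ                 ≡⟨ cong ((z ℚ.* y) ℚ.*_) (sym (ℚₚ.*-inverseʳ w)) ⟩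
    (z ℚ.* y) ℚ.* (w ℚ.* ℚ.1/ w)     ≡⟨ sym (swap z (ℚ.1/ w) w y) ⟩
    z ℚ.* ℚ.1/ w ℚ.* (w ℚ.* y)       ≡⟨ cong (z ℚ.* ℚ.1/ w ℚ.*_) (ℚₚ.*-comm w y) ⟩
    z ℚ.* ℚ.1/ w ℚ.* (y ℚ.* w)       ∎)
  where
  open ≡-Reasoning
  instance
    _ = ℚ.≢-nonZero y≢0
    _ = ℚ.≢-nonZero w≢0
  swap : ∀ a b c d → a ℚ.* b ℚ.* (c ℚ.* d) ≡ (a ℚ.* d) ℚ.* (c ℚ.* b)
  swap = solve 4 (λ a b c d → a :* b :* (c :* d) := (a :* d) :* (c :* b)) refl
    where open +-*-Solver

*-cong₄ : ∀ {x x′ y y′ z z′ w w′} → x ≡ x′ → y ≡ y′ → z ≡ z′ → w ≡ w′ →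
  x ℚ.* y ℚ.* z ℚ.* w ≡ x′ ℚ.* y′ ℚ.* z′ ℚ.* w′
*-cong₄ refl refl refl refl = refl

2^≡mkℚ : ∀ n → 2^ n ≡ mkℚ (ℤ.+ (2 ℕ.^ n)) 0 (Coprime.sym (Coprime.1-coprimeTo _))
2^≡mkℚ n = ℚₚ.normalize-coprime (Coprime.sym (Coprime.1-coprimeTo _))

2^-+ : ∀ m n → 2^ (m + n) ≡ 2^ m ℚ.* 2^ n
2^-+ m n = begin
  2^ (m + n)                                 ≡⟨ cong (λ k → ℤ.+ k ℚ./ 1) (ℕₚ.^-distribˡ-+-* 2 m n) ⟩
  ℤ.+ (2 ℕ.^ m ℕ.* 2 ℕ.^ n) ℚ./ 1              ≡⟨ cong (ℚ._/ 1) (ℤₚ.pos-* (2 ℕ.^ m) (2 ℕ.^ n)) ⟩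
  (ℤ.+ (2 ℕ.^ m) ℤ.* ℤ.+ (2 ℕ.^ n)) ℚ./ 1        ≡⟨ sym (cong₂ ℚ._*_ (2^≡mkℚ m) (2^≡mkℚ n)) ⟩
  2^ m ℚ.* 2^ n                              ∎
  where open ≡-Reasoning

2^-injective : ∀ {m n} → 2^ m ≡ 2^ n → 2 ℕ.^ m ≡ 2 ℕ.^ n
2^-injective {m} {n} e = ℤₚ.+-injective (cong ℚ.↥_ (trans (sym (2^≡mkℚ m)) (trans e (2^≡mkℚ n))))

2^≢0 : ∀ n → 2^ n ≢ 0ℚ
2^≢0 n e = ℕ.≢-nonZero⁻¹ (2 ℕ.^ n) {{ℕₚ.m^n≢0 2 n}}
  (ℤₚ.+-injective (cong ℚ.↥_ (trans (sym (2^≡mkℚ n)) e)))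

2^-2^≢0 : ∀ {n i} → i < n → 2^ n ℚ.- 2^ i ≢ 0ℚ
2^-2^≢0 {n} {i} i<n e =
  ℕₚ.<⇒≢ (ℕₚ.^-monoʳ-< 2 (ℕ.s≤s (ℕ.s≤s ℕ.z≤n)) i<n) (sym (2^-injective {n} {i} (x∙y⁻¹≈ε⇒x≈y _ _ e)))

2^-shift : ∀ a b c → 2^ (a + b) ℚ.- 2^ (a + c) ≡ (2^ b ℚ.- 2^ c) ℚ.* 2^ a
2^-shift a b c rewrite 2^-+ a b | 2^-+ a c =
  solve 3 (λ x y z → x :* y :- x :* z := (y :- z) :* x) refl (2^ a) (2^ b) (2^ c)
  where open +-*-Solver

2^-shift-* : ∀ a b c d → (2^ (a + b) ℚ.- 2^ (a + c)) ℚ.* 2^ d ≡ (2^ b ℚ.- 2^ c) ℚ.* 2^ (a + d)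
2^-shift-* a b c d = begin
  (2^ (a + b) ℚ.- 2^ (a + c)) ℚ.* 2^ d      ≡⟨ cong (ℚ._* 2^ d) (2^-shift a b c) ⟩
  (2^ b ℚ.- 2^ c) ℚ.* 2^ a ℚ.* 2^ d          ≡⟨ ℚₚ.*-assoc (2^ b ℚ.- 2^ c) _ _ ⟩
  (2^ b ℚ.- 2^ c) ℚ.* (2^ a ℚ.* 2^ d)        ≡⟨ cong ((2^ b ℚ.- 2^ c) ℚ.*_) (sym (2^-+ a d)) ⟩
  (2^ b ℚ.- 2^ c) ℚ.* 2^ (a + d)             ∎
  where open ≡-Reasoning

*-2^-interchange : ∀ x y m n → (x ℚ.* 2^ m) ℚ.* (y ℚ.* 2^ n) ≡ (x ℚ.* y) ℚ.* 2^ (m + n)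
*-2^-interchange x y m n =
  trans (interchange x (2^ m) y (2^ n)) (cong ((x ℚ.* y) ℚ.*_) (sym (2^-+ m n)))

*-2^-interchange₃ : ∀ x y z a b c →
  (x ℚ.* 2^ a) ℚ.* (y ℚ.* 2^ b) ℚ.* (z ℚ.* 2^ c) ≡ (x ℚ.* y ℚ.* z) ℚ.* 2^ (a + b + c)
*-2^-interchange₃ x y z a b c =
  trans (cong (ℚ._* (z ℚ.* 2^ c)) (*-2^-interchange x y a b)) (*-2^-interchange (x ℚ.* y) z (a + b) c)

*-2^-interchange₄ : ∀ x y z w a b c d →
  (x ℚ.* 2^ a) ℚ.* (y ℚ.* 2^ b) ℚ.* (z ℚ.* 2^ c) ℚ.* (w ℚ.* 2^ d) ≡ (x ℚ.* y ℚ.* z ℚ.* w) ℚ.* 2^ (a + b + c + d)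
*-2^-interchange₄ x y z w a b c d =
  trans (cong (ℚ._* (w ℚ.* 2^ d)) (*-2^-interchange₃ x y z a b c)) (*-2^-interchange (x ℚ.* y ℚ.* z) w (a + b + c) d)

*-2^-shiftʳ : ∀ u v x e y → u ℚ.* 2^ x ≡ v ℚ.* 2^ e → u ℚ.* 2^ (x + y) ≡ v ℚ.* 2^ (e + y)
*-2^-shiftʳ u v x e y eq = begin
  u ℚ.* 2^ (x + y)          ≡⟨ cong (u ℚ.*_) (2^-+ x y) ⟩
  u ℚ.* (2^ x ℚ.* 2^ y)     ≡⟨ sym (ℚₚ.*-assoc u _ _) ⟩
  u ℚ.* 2^ x ℚ.* 2^ y       ≡⟨ cong (ℚ._* 2^ y) eq ⟩
  v ℚ.* 2^ e ℚ.* 2^ y       ≡⟨ ℚₚ.*-assoc v _ _ ⟩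
  v ℚ.* (2^ e ℚ.* 2^ y)     ≡⟨ cong (v ℚ.*_) (sym (2^-+ e y)) ⟩
  v ℚ.* 2^ (e + y)          ∎
  where open ≡-Reasoning

∏-cong : ∀ k {f g : ℕ → ℚ} → (∀ i → f i ≡ g i) → ∏ k f ≡ ∏ k g
∏-cong zero    f≗g = refl
∏-cong (suc k) f≗g = cong₂ ℚ._*_ (∏-cong k f≗g) (f≗g k)

∏-+ : ∀ k m (f : ℕ → ℚ) → ∏ (k + m) f ≡ ∏ k f ℚ.* ∏ m (λ j → f (k + j))
∏-+ k zero    f = trans (cong (λ n → ∏ n f) (ℕₚ.+-identityʳ k)) (sym (ℚₚ.*-identityʳ _))
∏-+ k (suc m) f = begin
  ∏ (k + suc m) f                                       ≡⟨ cong (λ n → ∏ n f) (ℕₚ.+-suc k m) ⟩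
  ∏ (k + m) f ℚ.* f (k + m)                             ≡⟨ cong (ℚ._* f (k + m)) (∏-+ k m f) ⟩
  ∏ k f ℚ.* ∏ m (λ j → f (k + j)) ℚ.* f (k + m)         ≡⟨ ℚₚ.*-assoc (∏ k f) _ _ ⟩
  ∏ k f ℚ.* (∏ m (λ j → f (k + j)) ℚ.* f (k + m))       ∎
  where open ≡-Reasoning

∏-*-2^ : ∀ k m (f : ℕ → ℚ) → ∏ k (λ i → f i ℚ.* 2^ m) ≡ ∏ k f ℚ.* 2^ (k * m)
∏-*-2^ zero    m f = sym (ℚₚ.*-identityʳ 1ℚ)
∏-*-2^ (suc k) m f = begin
  ∏ k (λ i → f i ℚ.* 2^ m) ℚ.* (f k ℚ.* 2^ m)    ≡⟨ cong (ℚ._* (f k ℚ.* 2^ m)) (∏-*-2^ k m f) ⟩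
  ∏ k f ℚ.* 2^ (k * m) ℚ.* (f k ℚ.* 2^ m)        ≡⟨ *-2^-interchange (∏ k f) (f k) (k * m) m ⟩
  ∏ k f ℚ.* f k ℚ.* 2^ (k * m + m)               ≡⟨ cong (λ e → ∏ (suc k) f ℚ.* 2^ e) (ℕₚ.+-comm (k * m) m) ⟩
  ∏ (suc k) f ℚ.* 2^ (suc k * m)                 ∎
  where open ≡-Reasoning

∏-factor-2^ : ∀ k m {f g : ℕ → ℚ} → (∀ i → f i ≡ g i ℚ.* 2^ m) → ∏ k f ≡ ∏ k g ℚ.* 2^ (k * m)
∏-factor-2^ k m {g = g} f≗g = trans (∏-cong k f≗g) (∏-*-2^ k m g)

∏≢0 : ∀ k {f : ℕ → ℚ} → (∀ i → i < k → f i ≢ 0ℚ) → ∏ k f ≢ 0ℚ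
∏≢0 zero    f≢0 ()
∏≢0 (suc k) f≢0 = *≢0 (∏≢0 k (λ i i<k → f≢0 i (ℕₚ.m<n⇒m<1+n i<k))) (f≢0 k ℕₚ.≤-refl)

falling₂ : ℕ → ℕ → ℚ
falling₂ n k = ∏ k (λ i → 2^ n ℚ.- 2^ i)

falling₂≢0 : ∀ {n k} → k ≤ n → falling₂ n k ≢ 0ℚ
falling₂≢0 {n} {k} k≤n = ∏≢0 k (λ i i<k → 2^-2^≢0 (ℕₚ.<-≤-trans i<k k≤n))

falling₂-split : ∀ k r → falling₂ (k + r) k ℚ.* falling₂ r r ℚ.* 2^ (r * k) ≡ falling₂ (k + r) (k + r)
falling₂-split k r = begin
  falling₂ (k + r) k ℚ.* falling₂ r r ℚ.* 2^ (r * k)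
    ≡⟨ ℚₚ.*-assoc (falling₂ (k + r) k) _ _ ⟩
  falling₂ (k + r) k ℚ.* (falling₂ r r ℚ.* 2^ (r * k))
    ≡⟨ cong (falling₂ (k + r) k ℚ.*_) (sym (∏-factor-2^ r k (2^-shift k r))) ⟩
  falling₂ (k + r) k ℚ.* ∏ r (λ j → 2^ (k + r) ℚ.- 2^ (k + j))
    ≡⟨ sym (∏-+ k r (λ i → 2^ (k + r) ℚ.- 2^ i)) ⟩
  falling₂ (k + r) (k + r) ∎
  where open ≡-Reasoning

2^-cube-factor : ∀ m i c → (2^ (3 * m) ℚ.- 2^ (2 * m) ℚ.* 2^ i) ℚ.* 2^ c ≡ (2^ m ℚ.- 2^ i) ℚ.* 2^ (2 * m + c)
2^-cube-factor m i c =
  trans (cong₂ (λ x y → (2^ x ℚ.- y) ℚ.* 2^ c) (ℕₚ.+-comm m (2 * m)) (sym (2^-+ (2 * m) i)))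
        (2^-shift-* (2 * m) m i c)

2^-square-factor : ∀ m j c → (2^ (2 * m) ℚ.- 2^ (m + j)) ℚ.* 2^ c ≡ (2^ m ℚ.- 2^ j) ℚ.* 2^ (m + c)
2^-square-factor m j c =
  trans (cong (λ x → (2^ x ℚ.- 2^ (m + j)) ℚ.* 2^ c) (cong (m +_) (ℕₚ.+-identityʳ m)))
        (2^-shift-* m m j c)

module _ (α β k₀ k₁ k₂ k₃ : ℕ) where

  -- Verbatim copies of the local definitions of N2x8, so that N2x8 α β k₀ k₁ k₂ k₃ is
  -- definitionally numerator ÷' denominator.
  N₁ N₂ N₃ N₄ D₁ D₂ D₃ D₄ numerator denominator : ℚ
  N₁ = ∏ k₀ (λ i → (2^ α ℚ.- 2^ i) ℚ.* 2^ β)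
  N₂ = ∏ k₁ (λ i → (2^ (3 * β) ℚ.- 2^ (2 * β) ℚ.* 2^ i) ℚ.* 2^ α)
  N₃ = ∏ k₂ (λ i → (2^ (2 * β) ℚ.- 2^ (β + k₁ + i)) ℚ.* 2^ α)
  N₄ = ∏ k₃ (λ i → 2^ β ℚ.- 2^ (k₁ + k₂ + i))
  D₁ = ∏ k₀ (λ i → 2^ (k₀ + k₁ + k₂ + k₃) ℚ.- 2^ (k₁ + k₂ + k₃ + i))
  D₂ = ∏ k₁ (λ i → (2^ (3 * k₁) ℚ.- 2^ (2 * k₁) ℚ.* 2^ i) ℚ.* 2^ (k₀ + 2 * k₂ + k₃))
  D₃ = ∏ k₂ (λ i → (2^ (2 * k₂) ℚ.- 2^ (k₂ + i)) ℚ.* 2^ (k₀ + 2 * k₁ + k₃))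
  D₄ = ∏ k₃ (λ i → 2^ (k₁ + k₂ + k₃) ℚ.- 2^ (k₁ + k₂ + i))
  numerator   = N₁ ℚ.* N₂ ℚ.* N₃ ℚ.* N₄
  denominator = D₁ ℚ.* D₂ ℚ.* D₃ ℚ.* D₄

  numeratorExponent denominatorExponent : ℕ
  numeratorExponent   = k₀ * β + k₁ * (2 * β + α) + k₂ * (β + α)
  denominatorExponent = k₀ * (k₁ + k₂ + k₃) + k₁ * (2 * k₁ + (k₀ + 2 * k₂ + k₃))
                        + k₂ * (k₂ + (k₀ + 2 * k₁ + k₃)) + k₃ * (k₁ + k₂)

  numerator-normal : numerator ≡ falling₂ α k₀ ℚ.* falling₂ β (k₁ + k₂ + k₃) ℚ.* 2^ numeratorExponent
  numerator-normal = begin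
    N₁ ℚ.* N₂ ℚ.* N₃ ℚ.* N₄
      ≡⟨ *-cong₄ N₁-normal N₂-normal N₃-normal refl ⟩
    (falling₂ α k₀ ℚ.* 2^ (k₀ * β)) ℚ.* (falling₂ β k₁ ℚ.* 2^ (k₁ * (2 * β + α)))
      ℚ.* (Q₃ ℚ.* 2^ (k₂ * (β + α))) ℚ.* N₄
      ≡⟨ cong (ℚ._* N₄) (*-2^-interchange₃ (falling₂ α k₀) (falling₂ β k₁) Q₃
                                             (k₀ * β) (k₁ * (2 * β + α)) (k₂ * (β + α))) ⟩
    falling₂ α k₀ ℚ.* falling₂ β k₁ ℚ.* Q₃ ℚ.* 2^ numeratorExponent ℚ.* N₄
      ≡⟨ xy∙z≈xz∙y (falling₂ α k₀ ℚ.* falling₂ β k₁ ℚ.* Q₃) _ N₄ ⟩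
    falling₂ α k₀ ℚ.* falling₂ β k₁ ℚ.* Q₃ ℚ.* N₄ ℚ.* 2^ numeratorExponent
      ≡⟨ cong (ℚ._* 2^ numeratorExponent) β-rows ⟩
    falling₂ α k₀ ℚ.* falling₂ β (k₁ + k₂ + k₃) ℚ.* 2^ numeratorExponent ∎
    where
    open ≡-Reasoning
    Q₃ : ℚ
    Q₃ = ∏ k₂ (λ j → 2^ β ℚ.- 2^ (k₁ + j))
    N₁-normal : N₁ ≡ falling₂ α k₀ ℚ.* 2^ (k₀ * β)
    N₁-normal = ∏-*-2^ k₀ β _
    N₂-normal : N₂ ≡ falling₂ β k₁ ℚ.* 2^ (k₁ * (2 * β + α))
    N₂-normal = ∏-factor-2^ k₁ (2 * β + α) (λ i → 2^-cube-factor β i α)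
    N₃-normal : N₃ ≡ Q₃ ℚ.* 2^ (k₂ * (β + α))
    N₃-normal = ∏-factor-2^ k₂ (β + α) (λ i →
      trans (cong (λ e → (2^ (2 * β) ℚ.- 2^ e) ℚ.* 2^ α) (ℕₚ.+-assoc β k₁ i)) (2^-square-factor β (k₁ + i) α))
    β-rows : falling₂ α k₀ ℚ.* falling₂ β k₁ ℚ.* Q₃ ℚ.* N₄ ≡ falling₂ α k₀ ℚ.* falling₂ β (k₁ + k₂ + k₃)
    β-rows = begin
      falling₂ α k₀ ℚ.* falling₂ β k₁ ℚ.* Q₃ ℚ.* N₄
        ≡⟨ cong (ℚ._* N₄) (ℚₚ.*-assoc (falling₂ α k₀) _ _) ⟩
      falling₂ α k₀ ℚ.* (falling₂ β k₁ ℚ.* Q₃) ℚ.* N₄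
        ≡⟨ ℚₚ.*-assoc (falling₂ α k₀) _ _ ⟩
      falling₂ α k₀ ℚ.* (falling₂ β k₁ ℚ.* Q₃ ℚ.* N₄)
        ≡⟨ cong (λ x → falling₂ α k₀ ℚ.* (x ℚ.* N₄)) (sym (∏-+ k₁ k₂ (λ i → 2^ β ℚ.- 2^ i))) ⟩
      falling₂ α k₀ ℚ.* (falling₂ β (k₁ + k₂) ℚ.* N₄)
        ≡⟨ cong (falling₂ α k₀ ℚ.*_) (sym (∏-+ (k₁ + k₂) k₃ (λ i → 2^ β ℚ.- 2^ i))) ⟩
      falling₂ α k₀ ℚ.* falling₂ β (k₁ + k₂ + k₃) ∎

  denominator-normal : denominator ≡
    falling₂ k₀ k₀ ℚ.* falling₂ k₁ k₁ ℚ.* falling₂ k₂ k₂ ℚ.* falling₂ k₃ k₃ ℚ.* 2^ denominatorExponent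
  denominator-normal =
    trans (*-cong₄ D₁-normal D₂-normal D₃-normal D₄-normal)
          (*-2^-interchange₄ (falling₂ k₀ k₀) (falling₂ k₁ k₁) (falling₂ k₂ k₂) (falling₂ k₃ k₃)
            (k₀ * (k₁ + k₂ + k₃)) (k₁ * (2 * k₁ + (k₀ + 2 * k₂ + k₃))) (k₂ * (k₂ + (k₀ + 2 * k₁ + k₃))) (k₃ * (k₁ + k₂)))
    where
    k₀-last : k₀ + k₁ + k₂ + k₃ ≡ k₁ + k₂ + k₃ + k₀
    k₀-last = ℕ-solve (k₀ ∷ k₁ ∷ k₂ ∷ k₃ ∷ [])
    D₁-normal : D₁ ≡ falling₂ k₀ k₀ ℚ.* 2^ (k₀ * (k₁ + k₂ + k₃))
    D₁-normal = ∏-factor-2^ k₀ (k₁ + k₂ + k₃) (λ i →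
      trans (cong (λ e → 2^ e ℚ.- 2^ (k₁ + k₂ + k₃ + i)) k₀-last) (2^-shift (k₁ + k₂ + k₃) k₀ i))
    D₂-normal : D₂ ≡ falling₂ k₁ k₁ ℚ.* 2^ (k₁ * (2 * k₁ + (k₀ + 2 * k₂ + k₃)))
    D₂-normal = ∏-factor-2^ k₁ (2 * k₁ + (k₀ + 2 * k₂ + k₃)) (λ i → 2^-cube-factor k₁ i (k₀ + 2 * k₂ + k₃))
    D₃-normal : D₃ ≡ falling₂ k₂ k₂ ℚ.* 2^ (k₂ * (k₂ + (k₀ + 2 * k₁ + k₃)))
    D₃-normal = ∏-factor-2^ k₂ (k₂ + (k₀ + 2 * k₁ + k₃)) (λ i → 2^-square-factor k₂ i (k₀ + 2 * k₁ + k₃))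
    D₄-normal : D₄ ≡ falling₂ k₃ k₃ ℚ.* 2^ (k₃ * (k₁ + k₂))
    D₄-normal = ∏-factor-2^ k₃ (k₁ + k₂) (2^-shift (k₁ + k₂) k₃)

  denominator≢0 : denominator ≢ 0ℚ
  denominator≢0 = subst (_≢ 0ℚ) (sym denominator-normal)
    (*≢0 (*≢0 (*≢0 (*≢0 (full≢0 k₀) (full≢0 k₁)) (full≢0 k₂)) (full≢0 k₃)) (2^≢0 denominatorExponent))
    where
    full≢0 : ∀ n → falling₂ n n ≢ 0ℚ
    full≢0 n = falling₂≢0 {n} {n} ℕₚ.≤-refl

exponent-balance : ∀ k₀ k₁ k₂ k₃ a b → a * k₂ ≡ k₀ * k₃ →
  let α = k₀ + a; β = k₁ + k₂ + k₃ + b in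
  numeratorExponent α β k₀ k₁ k₂ k₃ + denominatorExponent α β a b k₃ k₂ + (k₀ * a + k₁ * (b + k₃ + k₂))
  ≡ numeratorExponent α β a b k₃ k₂ + denominatorExponent α β k₀ k₁ k₂ k₃ + (a * k₀ + b * (k₁ + k₂ + k₃))
exponent-balance k₀ k₁ k₂ k₃ a b ak₂≡k₀k₃ =
  ℕₚ.+-cancelʳ-≡ (k₀ * k₃) _ _ (trans identity (cong₂ _+_ refl ak₂≡k₀k₃))
  where
  -- The exponents are spelled out because the ring-solver macro treats defined names as atoms.
  identity :
    let α = k₀ + a; β = k₁ + k₂ + k₃ + b in
    (k₀ * β + k₁ * (2 * β + α) + k₂ * (β + α))
      + (a * (b + k₃ + k₂) + b * (2 * b + (a + 2 * k₃ + k₂)) + k₃ * (k₃ + (a + 2 * b + k₂)) + k₂ * (b + k₃))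
      + (k₀ * a + k₁ * (b + k₃ + k₂)) + k₀ * k₃
    ≡ (a * β + b * (2 * β + α) + k₃ * (β + α))
      + (k₀ * (k₁ + k₂ + k₃) + k₁ * (2 * k₁ + (k₀ + 2 * k₂ + k₃)) + k₂ * (k₂ + (k₀ + 2 * k₁ + k₃)) + k₃ * (k₁ + k₂))
      + (a * k₀ + b * (k₁ + k₂ + k₃)) + a * k₂
  identity = ℕ-solve (k₀ ∷ k₁ ∷ k₂ ∷ k₃ ∷ a ∷ b ∷ [])

cross-product-normal : ∀ k₀ k₁ k₂ k₃ a b {α β} → k₀ + a ≡ α → k₁ + k₂ + k₃ + b ≡ β →
  numerator α β k₀ k₁ k₂ k₃ ℚ.* denominator α β a b k₃ k₂ ℚ.* 2^ (a * k₀ + b * (k₁ + k₂ + k₃))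
  ≡ falling₂ α α ℚ.* falling₂ β β ℚ.* (falling₂ k₃ k₃ ℚ.* falling₂ k₂ k₂)
    ℚ.* 2^ (numeratorExponent α β k₀ k₁ k₂ k₃ + denominatorExponent α β a b k₃ k₂)
cross-product-normal k₀ k₁ k₂ k₃ a b {α} {β} refl refl = begin
  numerator α β k₀ k₁ k₂ k₃ ℚ.* denominator α β a b k₃ k₂ ℚ.* 2^ (a * k₀ + b * l)
    ≡⟨ cong₂ ℚ._*_ (cong₂ ℚ._*_ (numerator-normal α β k₀ k₁ k₂ k₃) (denominator-normal α β a b k₃ k₂))
                   (2^-+ (a * k₀) (b * l)) ⟩
  (falling₂ α k₀ ℚ.* falling₂ β l ℚ.* 2^ eN)
    ℚ.* (falling₂ a a ℚ.* falling₂ b b ℚ.* falling₂ k₃ k₃ ℚ.* falling₂ k₂ k₂ ℚ.* 2^ eD)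
    ℚ.* (2^ (a * k₀) ℚ.* 2^ (b * l))
    ≡⟨ regroup (falling₂ α k₀) (falling₂ β l) (2^ eN) (falling₂ a a) (falling₂ b b)
               (falling₂ k₃ k₃) (falling₂ k₂ k₂) (2^ eD) (2^ (a * k₀)) (2^ (b * l)) ⟩
  (falling₂ α k₀ ℚ.* falling₂ a a ℚ.* 2^ (a * k₀)) ℚ.* (falling₂ β l ℚ.* falling₂ b b ℚ.* 2^ (b * l))
    ℚ.* (falling₂ k₃ k₃ ℚ.* falling₂ k₂ k₂) ℚ.* (2^ eN ℚ.* 2^ eD)
    ≡⟨ *-cong₄ (falling₂-split k₀ a) (falling₂-split l b) refl (sym (2^-+ eN eD)) ⟩
  falling₂ α α ℚ.* falling₂ β β ℚ.* (falling₂ k₃ k₃ ℚ.* falling₂ k₂ k₂) ℚ.* 2^ (eN + eD) ∎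
  where
  open ≡-Reasoning
  l eN eD : ℕ
  l = k₁ + k₂ + k₃
  eN = numeratorExponent α β k₀ k₁ k₂ k₃
  eD = denominatorExponent α β a b k₃ k₂
  regroup : ∀ p q e r s t u f x y →
    (p ℚ.* q ℚ.* e) ℚ.* (r ℚ.* s ℚ.* t ℚ.* u ℚ.* f) ℚ.* (x ℚ.* y)
    ≡ (p ℚ.* r ℚ.* x) ℚ.* (q ℚ.* s ℚ.* y) ℚ.* (t ℚ.* u) ℚ.* (e ℚ.* f)
  regroup = solve 10 (λ p q e r s t u f x y →
    (p :* q :* e) :* (r :* s :* t :* u :* f) :* (x :* y)
    := (p :* r :* x) :* (q :* s :* y) :* (t :* u) :* (e :* f)) refl
    where open +-*-Solver

cross-products-equal : ∀ k₀ k₁ k₂ k₃ a b {α β} → k₀ + a ≡ α → k₁ + k₂ + k₃ + b ≡ β → a * k₂ ≡ k₀ * k₃ →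
  numerator α β k₀ k₁ k₂ k₃ ℚ.* denominator α β a b k₃ k₂ ≡ numerator α β a b k₃ k₂ ℚ.* denominator α β k₀ k₁ k₂ k₃
cross-products-equal k₀ k₁ k₂ k₃ a b {α} {β} refl refl ak₂≡k₀k₃ = *-cancelʳ-≡ (2^≢0 (x + y)) (begin
  P₁ ℚ.* 2^ (x + y)    ≡⟨ *-2^-shiftʳ P₁ G₁ x E y (cross-product-normal k₀ k₁ k₂ k₃ a b refl refl) ⟩
  G₁ ℚ.* 2^ (E + y)    ≡⟨ cong₂ (λ g e → g ℚ.* 2^ e) G₁≡G₂ (exponent-balance k₀ k₁ k₂ k₃ a b ak₂≡k₀k₃) ⟩
  G₂ ℚ.* 2^ (E′ + x)   ≡⟨ sym (*-2^-shiftʳ P₂ G₂ y E′ x (cross-product-normal a b k₃ k₂ k₀ k₁ (ℕₚ.+-comm a k₀) β≡)) ⟩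
  P₂ ℚ.* 2^ (y + x)    ≡⟨ cong (λ e → P₂ ℚ.* 2^ e) (ℕₚ.+-comm y x) ⟩
  P₂ ℚ.* 2^ (x + y)    ∎)
  where
  open ≡-Reasoning
  P₁ P₂ G₁ G₂ : ℚ
  P₁ = numerator α β k₀ k₁ k₂ k₃ ℚ.* denominator α β a b k₃ k₂
  P₂ = numerator α β a b k₃ k₂ ℚ.* denominator α β k₀ k₁ k₂ k₃
  G₁ = falling₂ α α ℚ.* falling₂ β β ℚ.* (falling₂ k₃ k₃ ℚ.* falling₂ k₂ k₂)
  G₂ = falling₂ α α ℚ.* falling₂ β β ℚ.* (falling₂ k₂ k₂ ℚ.* falling₂ k₃ k₃)
  x y E E′ : ℕ
  x = a * k₀ + b * (k₁ + k₂ + k₃)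
  y = k₀ * a + k₁ * (b + k₃ + k₂)
  E = numeratorExponent α β k₀ k₁ k₂ k₃ + denominatorExponent α β a b k₃ k₂
  E′ = numeratorExponent α β a b k₃ k₂ + denominatorExponent α β k₀ k₁ k₂ k₃
  G₁≡G₂ : G₁ ≡ G₂
  G₁≡G₂ = cong (falling₂ α α ℚ.* falling₂ β β ℚ.*_) (ℚₚ.*-comm (falling₂ k₃ k₃) (falling₂ k₂ k₂))
  β≡ : b + k₃ + k₂ + k₁ ≡ k₁ + k₂ + k₃ + b
  β≡ = ℕ-solve (k₁ ∷ k₂ ∷ k₃ ∷ b ∷ [])

complement-balance : ∀ k₀ a k₂ k₃ {α} → k₀ + a ≡ α → α * k₂ ≡ k₀ * (k₂ + k₃) → a * k₂ ≡ k₀ * k₃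
complement-balance k₀ a k₂ k₃ refl αk₂≡k₀[k₂+k₃] = ℕₚ.+-cancelˡ-≡ (k₀ * k₂) _ _ (begin
  k₀ * k₂ + a * k₂     ≡⟨ sym (ℕₚ.*-distribʳ-+ k₂ k₀ a) ⟩
  (k₀ + a) * k₂        ≡⟨ αk₂≡k₀[k₂+k₃] ⟩
  k₀ * (k₂ + k₃)       ≡⟨ ℕₚ.*-distribˡ-+ k₀ k₂ k₃ ⟩
  k₀ * k₂ + k₀ * k₃    ∎)
  where open ≡-Reasoning

N2x8-complement : ∀ k₀ k₁ k₂ k₃ a b {α β} → k₀ + a ≡ α → k₁ + k₂ + k₃ + b ≡ β → a * k₂ ≡ k₀ * k₃ →
  N2x8 α β k₀ k₁ k₂ k₃ ≡ N2x8 α β a b k₃ k₂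
N2x8-complement k₀ k₁ k₂ k₃ a b {α} {β} α≡ β≡ ak₂≡k₀k₃ =
  ÷'-cross (denominator≢0 α β k₀ k₁ k₂ k₃) (denominator≢0 α β a b k₃ k₂)
           (cross-products-equal k₀ k₁ k₂ k₃ a b α≡ β≡ ak₂≡k₀k₃)

lemma2 : (α β k₀ k₁ k₂ k₃ : ℕ) → k₀ ≤ α → k₁ + k₂ + k₃ ≤ β →
    α * k₂ ≡ k₀ * (k₂ + k₃) →
    N2x8 α β k₀ k₁ k₂ k₃ ≡ N2x8 α β (α ∸ k₀) (β ∸ (k₁ + k₂ + k₃)) k₃ k₂
lemma2 α β k₀ k₁ k₂ k₃ k₀≤α l≤β αk₂≡k₀[k₂+k₃] =
  N2x8-complement k₀ k₁ k₂ k₃ (α ∸ k₀) (β ∸ (k₁ + k₂ + k₃)) k₀+a≡α (ℕₚ.m+[n∸m]≡n l≤β)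
    (complement-balance k₀ (α ∸ k₀) k₂ k₃ k₀+a≡α αk₂≡k₀[k₂+k₃])
  where
  k₀+a≡α : k₀ + (α ∸ k₀) ≡ α
  k₀+a≡α = ℕₚ.m+[n∸m]≡n k₀≤α
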